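{- Let $s(n)$ denote the number of maximal independent sets of the square cactus $S(n)$. Then $s(1)=2$ and $s(n)=2s(n-1)$ for all $n\ge 2$; that is, $s(n)=2^n$ for all $n\ge 1$.
   Context: For $n\ge 1$, the square (ortho-rectangular) cactus $S(n)$ is the graph formed by a chain of $n$ 4-cycles $B_1,\dots,B_n$, where for each $1\le i\le n-1$ the consecutive cycles $B_i$ and $B_{i+1}$ share exactly one vertex, non-consecutive cycles share no vertex, every vertex lies in at most two cycles, and for each $2\le i\le n-1$ the two shared (cut) vertices of $B_i$ are adjacent. An independent set is maximal if no further vertex can be added while keeping it independent. -}

module Defs where

open import Data.Nat using (ℕ; zero; suc; _+_; _*_)
open import Data.Nat.Properties using (_≟_)
open import Data.Nat.Divisibility using (_∣_; _∣?_)
open import Data.Fin using (Fin; toℕ)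
open import Data.Fin.Properties using (all?; any?)
open import Data.Fin.Subset using (Subset; _∈_; _∉_; inside; outside)
open import Data.Fin.Subset.Properties using (_∈?_)
open import Data.Vec using (_∷_; [])
open import Data.List using (List; []; _∷_; map; _++_; filter; length)
open import Data.Product using (_×_; ∃; _,_)
open import Data.Sum using (_⊎_)
open import Relation.Nullary using (¬_; Dec)
open import Relation.Nullary.Decidable using (_×-dec_; _⊎-dec_; ¬?; _→-dec_)
open import Relation.Binary.PropositionalEquality using (_≡_)

-- For 1 ≤ i ≤ n the
-- block B_i is the 4-cycle on the vertices
--     c_{i-1} = 3i-3,  a_i = 3i-2,  b_i = 3i-1,  c_i = 3i
-- with edges c_{i-1}a_i, a_i b_i, b_i c_i, c_i c_{i-1}.
-- Consecutive blocks B_i, B_{i+1} share exactly the cut vertex c_i = 3i,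
-- and the two cut vertices c_{i-1}, c_i of each inner block are adjacent.
-- Equivalently: the edges are the path edges {u, u+1} (0 ≤ u < 3n) and the
-- chords {3j, 3j+3} (0 ≤ j < n).

Edge : ℕ → ℕ → Set
Edge u v = (v ≡ suc u) ⊎ ((3 ∣ u) × (v ≡ u + 3))

edge? : (u v : ℕ) → Dec (Edge u v)
edge? u v = (v ≟ suc u) ⊎-dec ((3 ∣? u) ×-dec (v ≟ u + 3))

order : ℕ → ℕ
order n = suc (3 * n)

Vertex : ℕ → Set
Vertex n = Fin (order n)

Adj : (n : ℕ) → Vertex n → Vertex n → Set
Adj n u v = Edge (toℕ u) (toℕ v) ⊎ Edge (toℕ v) (toℕ u)

adj? : (n : ℕ) → (u v : Vertex n) → Dec (Adj n u v)
adj? n u v = edge? (toℕ u) (toℕ v) ⊎-dec edge? (toℕ v) (toℕ u)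

IsIndependent : (n : ℕ) → Subset (order n) → Set
IsIndependent n S = ∀ u v → u ∈ S → v ∈ S → ¬ Adj n u v

-- maximal: every vertex outside S has a neighbour in S
-- (i.e. no vertex can be added keeping independence)
IsMaximalIndependent : (n : ℕ) → Subset (order n) → Set
IsMaximalIndependent n S =
  IsIndependent n S × (∀ v → v ∉ S → ∃ λ u → u ∈ S × Adj n u v)

isIndependent? : (n : ℕ) → (S : Subset (order n)) → Dec (IsIndependent n S)
isIndependent? n S =
  all? λ u → all? λ v → (u ∈? S) →-dec ((v ∈? S) →-dec ¬? (adj? n u v))

isMaximalIndependent? : (n : ℕ) → (S : Subset (order n)) →
                        Dec (IsMaximalIndependent n S)
isMaximalIndependent? n S =
  isIndependent? n S ×-dec
  (all? λ v → ¬? (v ∈? S) →-dec any? λ u → (u ∈? S) ×-dec adj? n u v)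

allSubsets : (m : ℕ) → List (Subset m)
allSubsets zero = [] ∷ []
allSubsets (suc m) =
  map (outside ∷_) (allSubsets m) ++ map (inside ∷_) (allSubsets m)

s : ℕ → ℕ
s n = length (filter (isMaximalIndependent? n) (allSubsets (order n)))

module Submission where

-- The graph on 3 + k vertices is c₀, a₁, b₁ of its first square followed by a shifted
-- copy of the graph on k vertices, whose first vertex, the root, is the cut vertex c₁.
-- Sort the sets of a graph by its root: maximal independent with the root inside
-- (RootIn) or outside (RootOut), or independent with the root outside and every other
-- vertex dominated (RootFree), which splits into RootOut and the sets leaving the root
-- undominated (RootUndominated).  In each class of the larger graph the trace on
-- c₀ a₁ b₁ is forced (in/out/in, out/in/out, out/out/in), and the rest is respectively
-- RootFree, maximal independent, RootFree.  So the counts (a, b, c) become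
-- (b + c, a + b, b + c); from (1, 0, 1) on one vertex they are all 2ᵐ on S(m + 1),
-- and s(m + 1) = a + b.

open import Defs
open import Data.Bool using (Bool; true; false)
open import Data.Empty using (⊥; ⊥-elim)
open import Data.Fin using (Fin; zero; suc; toℕ)
open import Data.Fin.Patterns using (0F; 1F; 2F; 3F)
open import Data.Fin.Properties using (all?; any?; toℕ-injective)
open import Data.Fin.Subset using (Subset; _∈_; _∉_; inside; outside)
open import Data.Fin.Subset.Properties using (_∈?_)
open import Data.List using (List; []; _∷_; map; filter; length)
open import Data.List.Properties using (length-++; filter-++; filter-≐; filter-none)
open import Data.List.Relation.Unary.All using (universal)
open import Data.Nat using (ℕ; zero; suc; _+_; _*_; _∸_; _^_; _<_; _≥_; s≤s; z≤n)
open import Data.Nat.Divisibility using (_∣0; n∣n; ∣m∣n⇒∣m+n; ∣m+n∣m⇒∣n; >⇒∤)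
open import Data.Nat.Properties using (+-identityʳ; +-suc; *-suc; n<1+n; m<m+n; <-irrefl)
open import Data.Product using (_×_; _,_; proj₁; proj₂; ∃)
open import Data.Sum as Sum using (_⊎_; inj₁; inj₂; swap; [_,_]′)
open import Data.Vec using (_∷_; []; _++_; splitAt)
open import Data.Vec.Properties using (∷-injectiveˡ; ∷-injectiveʳ)
open import Data.Vec.Base using (here; there)
open import Function using (_∘_; id)
open import Function.Bundles using (_⇔_; mk⇔; Equivalence)
open import Level using (0ℓ)
open import Relation.Binary.PropositionalEquality
  using (_≡_; refl; sym; trans; cong; cong₂; subst; module ≡-Reasoning)
open import Relation.Nullary using (Dec; yes; no; ¬_; does)
open import Relation.Nullary.Decidable using (_×-dec_; _⊎-dec_; ¬?; _→-dec_)
open import Relation.Unary using (Pred; Decidable; _∩_; ∁; _≐_)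
open import Relation.Unary.Properties using (_∩?_; ∁?)

open Equivalence using (to; from)

length-filter-map : ∀ {A B : Set} {P : Pred B 0ℓ} (P? : Decidable P) (f : A → B) (xs : List A) →
  length (filter P? (map f xs)) ≡ length (filter (P? ∘ f) xs)
length-filter-map P? f [] = refl
length-filter-map P? f (x ∷ xs) with does (P? (f x))
... | true  = cong suc (length-filter-map P? f xs)
... | false = length-filter-map P? f xs

length-filter-split : ∀ {A : Set} {P Q : Pred A 0ℓ} (P? : Decidable P) (Q? : Decidable Q) (xs : List A) →
  length (filter P? xs) ≡ length (filter (P? ∩? Q?) xs) + length (filter (P? ∩? ∁? Q?) xs)
length-filter-split P? Q? [] = refl
length-filter-split P? Q? (x ∷ xs) with P? x | Q? x
... | yes _ | yes _ = cong suc (length-filter-split P? Q? xs)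
... | yes _ | no _  = trans (cong suc (length-filter-split P? Q? xs)) (sym (+-suc _ _))
... | no _  | yes _ = length-filter-split P? Q? xs
... | no _  | no _  = length-filter-split P? Q? xs

count : (k : ℕ) {P : Pred (Subset k) 0ℓ} → Decidable P → ℕ
count k P? = length (filter P? (allSubsets k))

module _ {k : ℕ} where

  count-≐ : {P Q : Pred (Subset k) 0ℓ} (P? : Decidable P) (Q? : Decidable Q) →
    P ≐ Q → count k P? ≡ count k Q?
  count-≐ P? Q? P≐Q = cong length (filter-≐ P? Q? P≐Q (allSubsets k))

  count-none : {P : Pred (Subset k) 0ℓ} (P? : Decidable P) → (∀ S → ¬ P S) → count k P? ≡ 0
  count-none P? ¬P = cong length (filter-none P? (universal ¬P (allSubsets k)))

  count-split : {P Q : Pred (Subset k) 0ℓ} (P? : Decidable P) (Q? : Decidable Q) →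
    count k P? ≡ count k (P? ∩? Q?) + count k (P? ∩? ∁? Q?)
  count-split P? Q? = length-filter-split P? Q? (allSubsets k)

  count-cons : {P : Pred (Subset (suc k)) 0ℓ} (P? : Decidable P) →
    count (suc k) P? ≡ count k (P? ∘ (outside ∷_)) + count k (P? ∘ (inside ∷_))
  count-cons P? = begin
      length (filter P? (map (outside ∷_) Ss Data.List.++ map (inside ∷_) Ss))
    ≡⟨ cong length (filter-++ P? (map (outside ∷_) Ss) _) ⟩
      length (filter P? (map (outside ∷_) Ss) Data.List.++ filter P? (map (inside ∷_) Ss))
    ≡⟨ length-++ (filter P? (map (outside ∷_) Ss)) ⟩
      length (filter P? (map (outside ∷_) Ss)) + length (filter P? (map (inside ∷_) Ss))
    ≡⟨ cong₂ _+_ (length-filter-map P? (outside ∷_) Ss) (length-filter-map P? (inside ∷_) Ss) ⟩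
      count k (P? ∘ (outside ∷_)) + count k (P? ∘ (inside ∷_))
    ∎
    where
    open ≡-Reasoning
    Ss = allSubsets k

uniquePrefix⇒head : ∀ m {k} {P : Pred (Subset (suc m + k)) 0ℓ} {b p} →
  (∀ q T → P (q ++ T) → q ≡ b ∷ p) → ∀ c S → P (c ∷ S) → c ≡ b
uniquePrefix⇒head m unique c S PcS with splitAt m S
... | q , T , refl = ∷-injectiveˡ (unique (c ∷ q) T PcS)

count-uniquePrefix : ∀ m {k} (p : Subset m) {P : Pred (Subset (m + k)) 0ℓ} (P? : Decidable P)
  {Q : Pred (Subset k) 0ℓ} (Q? : Decidable Q) →
  (∀ q T → P (q ++ T) → q ≡ p) → (∀ T → P (p ++ T) ⇔ Q T) → count (m + k) P? ≡ count k Q?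
count-uniquePrefix zero [] P? Q? _ P⇔Q = count-≐ P? Q? (to (P⇔Q _) , from (P⇔Q _))
count-uniquePrefix (suc m) (false ∷ p) {P} P? Q? unique P⇔Q = begin
    count (suc m + _) P?
  ≡⟨ count-cons P? ⟩
    count (m + _) (P? ∘ (false ∷_)) + count (m + _) (P? ∘ (true ∷_))
  ≡⟨ cong₂ _+_ (count-uniquePrefix m p _ Q? (λ q T → ∷-injectiveʳ ∘ unique (false ∷ q) T) P⇔Q)
               (count-none _ λ S → (λ ()) ∘ uniquePrefix⇒head m {P = P} unique true S) ⟩
    count _ Q? + 0
  ≡⟨ +-identityʳ _ ⟩
    count _ Q?
  ∎
  where open ≡-Reasoning
count-uniquePrefix (suc m) (true ∷ p) {P} P? Q? unique P⇔Q = begin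
    count (suc m + _) P?
  ≡⟨ count-cons P? ⟩
    count (m + _) (P? ∘ (false ∷_)) + count (m + _) (P? ∘ (true ∷_))
  ≡⟨ cong₂ _+_ (count-none _ λ S → (λ ()) ∘ uniquePrefix⇒head m {P = P} unique false S)
               (count-uniquePrefix m p _ Q? (λ q T → ∷-injectiveʳ ∘ unique (true ∷ q) T) P⇔Q) ⟩
    count _ Q?
  ∎
  where open ≡-Reasoning

infix 4 _~_ _~?_

_~_ : ℕ → ℕ → Set
u ~ v = Edge u v ⊎ Edge v u

_~?_ : (u v : ℕ) → Dec (u ~ v)
u ~? v = edge? u v ⊎-dec edge? v u

edge⇒< : ∀ {u v} → Edge u v → u < v
edge⇒< (inj₁ refl) = n<1+n _
edge⇒< (inj₂ (_ , refl)) = m<m+n _ (s≤s z≤n)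

~-irrefl : ∀ {u} → ¬ u ~ u
~-irrefl (inj₁ e) = <-irrefl refl (edge⇒< e)
~-irrefl (inj₂ e) = <-irrefl refl (edge⇒< e)

edge-lower : ∀ {a b} → Edge (3 + a) (3 + b) → Edge a b
edge-lower (inj₁ refl) = inj₁ refl
edge-lower (inj₂ (3∣3+a , refl)) = inj₂ (∣m+n∣m⇒∣n 3∣3+a n∣n , refl)

edge-raise : ∀ {a b} → Edge a b → Edge (3 + a) (3 + b)
edge-raise (inj₁ refl) = inj₁ refl
edge-raise (inj₂ (3∣a , refl)) = inj₂ (∣m∣n⇒∣m+n n∣n 3∣a , refl)

3+a~3+b⇒a~b : ∀ {a b} → 3 + a ~ 3 + b → a ~ b
3+a~3+b⇒a~b = Sum.map edge-lower edge-lower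

a~b⇒3+a~3+b : ∀ {a b} → a ~ b → 3 + a ~ 3 + b
a~b⇒3+a~3+b = Sum.map edge-raise edge-raise

0~1 : 0 ~ 1
0~1 = inj₁ (inj₁ refl)

1~2 : 1 ~ 2
1~2 = inj₁ (inj₁ refl)

0~3 : 0 ~ 3
0~3 = inj₁ (inj₂ (3 ∣0 , refl))

2~3 : 2 ~ 3
2~3 = inj₁ (inj₁ refl)

0≁2 : ¬ 0 ~ 2
0≁2 (inj₁ (inj₁ ()))
0≁2 (inj₁ (inj₂ (_ , ())))
0≁2 (inj₂ (inj₁ ()))
0≁2 (inj₂ (inj₂ (_ , ())))

0~3+b⇒b≡0 : ∀ {b} → 0 ~ 3 + b → b ≡ 0
0~3+b⇒b≡0 (inj₁ (inj₁ ()))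
0~3+b⇒b≡0 (inj₁ (inj₂ (_ , refl))) = refl
0~3+b⇒b≡0 (inj₂ (inj₁ ()))
0~3+b⇒b≡0 (inj₂ (inj₂ (_ , ())))

1≁3+b : ∀ {b} → ¬ 1 ~ 3 + b
1≁3+b (inj₁ (inj₁ ()))
1≁3+b (inj₁ (inj₂ (3∣1 , _))) = >⇒∤ (s≤s (s≤s z≤n)) 3∣1
1≁3+b (inj₂ (inj₁ ()))
1≁3+b (inj₂ (inj₂ (_ , ())))

2~3+b⇒b≡0 : ∀ {b} → 2 ~ 3 + b → b ≡ 0
2~3+b⇒b≡0 (inj₁ (inj₁ refl)) = refl
2~3+b⇒b≡0 (inj₁ (inj₂ (3∣2 , _))) = ⊥-elim (>⇒∤ (s≤s (s≤s (s≤s z≤n))) 3∣2)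
2~3+b⇒b≡0 (inj₂ (inj₁ ()))
2~3+b⇒b≡0 (inj₂ (inj₂ (_ , ())))

-- The first k vertices of the infinite square cactus; S(n) is the case k = order n.
module _ (k : ℕ) where

  Independent : Pred (Subset k) 0ℓ
  Independent S = ∀ u v → u ∈ S → v ∈ S → ¬ toℕ u ~ toℕ v

  Dominated : Subset k → Pred (Fin k) 0ℓ
  Dominated S v = ∃ λ u → u ∈ S × toℕ u ~ toℕ v

  Maximal : Pred (Subset k) 0ℓ
  Maximal S = Independent S × (∀ v → v ∉ S → Dominated S v)

  independent? : Decidable Independent
  independent? S = all? λ u → all? λ v → (u ∈? S) →-dec ((v ∈? S) →-dec ¬? (toℕ u ~? toℕ v))

  dominated? : (S : Subset k) → Decidable (Dominated S)
  dominated? S v = any? λ u → (u ∈? S) ×-dec (toℕ u ~? toℕ v)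

  maximal? : Decidable Maximal
  maximal? S = independent? S ×-dec (all? λ v → ¬? (v ∈? S) →-dec dominated? S v)

module _ (j : ℕ) where

  MaximalOffRoot : Pred (Subset (suc j)) 0ℓ
  MaximalOffRoot S = Independent (suc j) S × (∀ w → suc w ∉ S → Dominated (suc j) S (suc w))

  maximalOffRoot? : Decidable MaximalOffRoot
  maximalOffRoot? S =
    independent? (suc j) S ×-dec (all? λ w → ¬? (suc w ∈? S) →-dec dominated? (suc j) S (suc w))

  RootIn RootOut RootFree RootUndominated : Pred (Subset (suc j)) 0ℓ
  RootIn = Maximal (suc j) ∩ (zero ∈_)
  RootOut = Maximal (suc j) ∩ ∁ (zero ∈_)
  RootFree = MaximalOffRoot ∩ ∁ (zero ∈_)
  RootUndominated = RootFree ∩ ∁ (λ S → Dominated (suc j) S zero)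

  rootIn? : Decidable RootIn
  rootIn? = maximal? (suc j) ∩? (zero ∈?_)

  rootOut? : Decidable RootOut
  rootOut? = maximal? (suc j) ∩? ∁? (zero ∈?_)

  rootFree? : Decidable RootFree
  rootFree? = maximalOffRoot? ∩? ∁? (zero ∈?_)

  rootUndominated? : Decidable RootUndominated
  rootUndominated? = rootFree? ∩? ∁? (λ S → dominated? (suc j) S zero)

pattern suc³ w = suc (suc (suc w))
pattern there³ p = there (there (there p))

maximal⇒maximalOffRoot : ∀ {j S} → Maximal (suc j) S → MaximalOffRoot j S
maximal⇒maximalOffRoot (I , D) = I , D ∘ suc

maximalOffRoot⇒maximal : ∀ {j S} → MaximalOffRoot j S → (zero ∉ S → Dominated (suc j) S zero) →
  Maximal (suc j) S
maximalOffRoot⇒maximal (I , D) D₀ = I , λ where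
  zero    → D₀
  (suc w) → D w

-- In the graph on 3 + suc j vertices, 0F, 1F, 2F are c₀, a₁, b₁ and 3F = suc³ zero is c₁.
module _ {j : ℕ} where

  module _ {x y z : Bool} {T : Subset (suc j)} where

    toℕ≡0⇒zero∈ : ∀ {w} → toℕ w ≡ 0 → w ∈ T → zero ∈ T
    toℕ≡0⇒zero∈ w≡0 = subst (_∈ T) (toℕ-injective w≡0)

    independent-restrict : Independent (3 + suc j) (x ∷ y ∷ z ∷ T) → Independent (suc j) T
    independent-restrict I u v u∈ v∈ u~v = I (suc³ u) (suc³ v) (there³ u∈) (there³ v∈) (a~b⇒3+a~3+b u~v)

    independent-extend : Independent (suc j) T →
      (x ≡ true → y ≡ true → ⊥) → (y ≡ true → z ≡ true → ⊥) →
      (x ≡ true → zero ∉ T) → (z ≡ true → zero ∉ T) →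
      Independent (3 + suc j) (x ∷ y ∷ z ∷ T)
    independent-extend I x∧y y∧z x⇒ z⇒ = λ where
      0F       0F       _           _           a → ~-irrefl a
      0F       1F       here        (there here) _ → x∧y refl refl
      0F       2F       _           _           a → 0≁2 a
      0F       (suc³ w) here        (there³ w∈) a → x⇒ refl (toℕ≡0⇒zero∈ (0~3+b⇒b≡0 a) w∈)
      1F       0F       (there here) here       _ → x∧y refl refl
      1F       1F       _           _           a → ~-irrefl a
      1F       2F       (there here) (there (there here)) _ → y∧z refl refl
      1F       (suc³ _) _           _           a → 1≁3+b a
      2F       0F       _           _           a → 0≁2 (swap a)
      2F       1F       (there (there here)) (there here) _ → y∧z refl refl
      2F       2F       _           _           a → ~-irrefl a
      2F       (suc³ w) (there (there here)) (there³ w∈) a → z⇒ refl (toℕ≡0⇒zero∈ (2~3+b⇒b≡0 a) w∈)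
      (suc³ w) 0F       (there³ w∈) here        a → x⇒ refl (toℕ≡0⇒zero∈ (0~3+b⇒b≡0 (swap a)) w∈)
      (suc³ _) 1F       _           _           a → 1≁3+b (swap a)
      (suc³ w) 2F       (there³ w∈) (there (there here)) a → z⇒ refl (toℕ≡0⇒zero∈ (2~3+b⇒b≡0 (swap a)) w∈)
      (suc³ u) (suc³ v) (there³ u∈) (there³ v∈) a → I u v u∈ v∈ (3+a~3+b⇒a~b a)

    dominated-extend : ∀ {w} → Dominated (suc j) T w → Dominated (3 + suc j) (x ∷ y ∷ z ∷ T) (suc³ w)
    dominated-extend (u , u∈ , a) = suc³ u , there³ u∈ , a~b⇒3+a~3+b a

    dominated-restrict : ∀ {w} → Dominated (3 + suc j) (x ∷ y ∷ z ∷ T) (suc³ w) →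
      Dominated (suc j) T w ⊎ (w ≡ zero × (x ≡ true ⊎ z ≡ true))
    dominated-restrict (0F , here , a) = inj₂ (toℕ-injective (0~3+b⇒b≡0 a) , inj₁ refl)
    dominated-restrict (1F , _ , a) = ⊥-elim (1≁3+b a)
    dominated-restrict (2F , there (there here) , a) = inj₂ (toℕ-injective (2~3+b⇒b≡0 a) , inj₂ refl)
    dominated-restrict (suc³ u , there³ u∈ , a) = inj₁ (u , u∈ , 3+a~3+b⇒a~b a)

    dominated-0F : Dominated (3 + suc j) (x ∷ y ∷ z ∷ T) 0F → y ≡ true ⊎ zero ∈ T
    dominated-0F (0F , _ , a) = ⊥-elim (~-irrefl a)
    dominated-0F (1F , there here , _) = inj₁ refl
    dominated-0F (2F , _ , a) = ⊥-elim (0≁2 (swap a))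
    dominated-0F (suc³ u , there³ u∈ , a) = inj₂ (toℕ≡0⇒zero∈ (0~3+b⇒b≡0 (swap a)) u∈)

    dominated-1F : Dominated (3 + suc j) (x ∷ y ∷ z ∷ T) 1F → x ≡ true ⊎ z ≡ true
    dominated-1F (0F , here , _) = inj₁ refl
    dominated-1F (1F , _ , a) = ⊥-elim (~-irrefl a)
    dominated-1F (2F , there (there here) , _) = inj₂ refl
    dominated-1F (suc³ _ , _ , a) = ⊥-elim (1≁3+b (swap a))

    dominated-2F : Dominated (3 + suc j) (x ∷ y ∷ z ∷ T) 2F → y ≡ true ⊎ zero ∈ T
    dominated-2F (0F , _ , a) = ⊥-elim (0≁2 a)
    dominated-2F (1F , there here , _) = inj₁ refl
    dominated-2F (2F , _ , a) = ⊥-elim (~-irrefl a)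
    dominated-2F (suc³ u , there³ u∈ , a) = inj₂ (toℕ≡0⇒zero∈ (2~3+b⇒b≡0 (swap a)) u∈)

    maximalOffRoot-restrict : MaximalOffRoot (3 + j) (x ∷ y ∷ z ∷ T) → MaximalOffRoot j T
    maximalOffRoot-restrict (I , D) = independent-restrict I , λ w w∉ →
      [ id , (λ { (() , _) }) ]′ (dominated-restrict (D (suc³ w) λ { (there³ w∈) → w∉ w∈ }))

    maximalOffRoot-extend : Independent (3 + suc j) (x ∷ y ∷ z ∷ T) →
      (1F ∉ x ∷ y ∷ z ∷ T → Dominated (3 + suc j) (x ∷ y ∷ z ∷ T) 1F) →
      (2F ∉ x ∷ y ∷ z ∷ T → Dominated (3 + suc j) (x ∷ y ∷ z ∷ T) 2F) →
      (3F ∉ x ∷ y ∷ z ∷ T → Dominated (3 + suc j) (x ∷ y ∷ z ∷ T) 3F) →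
      MaximalOffRoot j T → MaximalOffRoot (3 + j) (x ∷ y ∷ z ∷ T)
    maximalOffRoot-extend I D₁ D₂ D₃ (_ , D) = I , λ where
      0F           → D₁
      1F           → D₂
      2F           → D₃
      (suc³ w) w∉ → dominated-extend (D w (w∉ ∘ there³))

  rootIn-prefix : ∀ q T → RootIn (3 + j) (q ++ T) → q ≡ true ∷ false ∷ true ∷ []
  rootIn-prefix (false ∷ _ ∷ _ ∷ []) T (_ , ())
  rootIn-prefix (true ∷ true ∷ _ ∷ []) T ((I , _) , _) = ⊥-elim (I 0F 1F here (there here) 0~1)
  rootIn-prefix (true ∷ false ∷ false ∷ []) T ((I , D) , _) =
    [ (λ ()) , (λ r∈ → ⊥-elim (I 0F 3F here (there³ r∈) 0~3)) ]′
      (dominated-2F (D 2F λ { (there (there ())) }))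
  rootIn-prefix (true ∷ false ∷ true ∷ []) T _ = refl

  rootIn⇔rootFree : ∀ {T} → RootIn (3 + j) (true ∷ false ∷ true ∷ T) ⇔ RootFree j T
  rootIn⇔rootFree = mk⇔
    (λ (M , _) → maximalOffRoot-restrict (maximal⇒maximalOffRoot M) ,
                 λ r∈ → proj₁ M 0F 3F here (there³ r∈) 0~3)
    (λ (M , r∉) →
      maximalOffRoot⇒maximal
        (maximalOffRoot-extend (independent-extend (proj₁ M) (λ _ ()) (λ ()) (λ _ → r∉) (λ _ → r∉))
          (λ _ → 0F , here , 0~1) (λ 2∉ → ⊥-elim (2∉ (there (there here)))) (λ _ → 0F , here , 0~3) M)
        (λ 0∉ → ⊥-elim (0∉ here)) ,
      here)

  rootOut-prefix : ∀ q T → RootOut (3 + j) (q ++ T) → q ≡ false ∷ true ∷ false ∷ []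
  rootOut-prefix (true ∷ _ ∷ _ ∷ []) T (_ , 0∉) = ⊥-elim (0∉ here)
  rootOut-prefix (false ∷ false ∷ false ∷ []) T ((_ , D) , _) =
    [ (λ ()) , (λ ()) ]′ (dominated-1F (D 1F λ { (there ()) }))
  rootOut-prefix (false ∷ false ∷ true ∷ []) T ((I , D) , _) =
    [ (λ ()) , (λ r∈ → ⊥-elim (I 2F 3F (there (there here)) (there³ r∈) 2~3)) ]′
      (dominated-0F (D 0F λ ()))
  rootOut-prefix (false ∷ true ∷ true ∷ []) T ((I , _) , _) =
    ⊥-elim (I 1F 2F (there here) (there (there here)) 1~2)
  rootOut-prefix (false ∷ true ∷ false ∷ []) T _ = refl

  rootOut⇔maximal : ∀ {T} → RootOut (3 + j) (false ∷ true ∷ false ∷ T) ⇔ Maximal (suc j) T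
  rootOut⇔maximal = mk⇔
    (λ (M , _) → maximalOffRoot⇒maximal (maximalOffRoot-restrict (maximal⇒maximalOffRoot M)) λ r∉ →
      [ id , (λ { (_ , inj₁ ()) ; (_ , inj₂ ()) }) ]′
        (dominated-restrict (proj₂ M 3F λ { (there³ r∈) → r∉ r∈ })))
    (λ M →
      maximalOffRoot⇒maximal
        (maximalOffRoot-extend (independent-extend (proj₁ M) (λ ()) (λ _ ()) (λ ()) (λ ()))
          (λ 1∉ → ⊥-elim (1∉ (there here))) (λ _ → 1F , there here , 1~2)
          (λ 3∉ → dominated-extend (proj₂ M zero (3∉ ∘ there³))) (maximal⇒maximalOffRoot M))
        (λ _ → 1F , there here , swap 0~1) ,
      λ ())

  rootUndominated-prefix : ∀ q T → RootUndominated (3 + j) (q ++ T) → q ≡ false ∷ false ∷ true ∷ []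
  rootUndominated-prefix (true ∷ _ ∷ _ ∷ []) T ((_ , 0∉) , _) = ⊥-elim (0∉ here)
  rootUndominated-prefix (false ∷ true ∷ _ ∷ []) T (_ , ¬dom) = ⊥-elim (¬dom (1F , there here , swap 0~1))
  rootUndominated-prefix (false ∷ false ∷ false ∷ []) T (((_ , D) , _) , _) =
    [ (λ ()) , (λ ()) ]′ (dominated-1F (D 0F λ { (there ()) }))
  rootUndominated-prefix (false ∷ false ∷ true ∷ []) T _ = refl

  rootUndominated⇔rootFree : ∀ {T} → RootUndominated (3 + j) (false ∷ false ∷ true ∷ T) ⇔ RootFree j T
  rootUndominated⇔rootFree = mk⇔
    (λ ((M , _) , _) → maximalOffRoot-restrict M ,
                       λ r∈ → proj₁ M 2F 3F (there (there here)) (there³ r∈) 2~3)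
    (λ (M , r∉) →
      (maximalOffRoot-extend (independent-extend (proj₁ M) (λ ()) (λ ()) (λ ()) (λ _ → r∉))
         (λ _ → 2F , there (there here) , swap 1~2) (λ 2∉ → ⊥-elim (2∉ (there (there here))))
         (λ _ → 2F , there (there here) , 2~3) M ,
       λ ()) ,
      [ (λ ()) , r∉ ]′ ∘ dominated-0F)

#Maximal : ℕ → ℕ
#Maximal k = count k (maximal? k)

s≡#Maximal : ∀ n → s n ≡ #Maximal (order n)
s≡#Maximal n = refl

#RootIn #RootOut #RootFree #RootUndominated : ℕ → ℕ
#RootIn j = count (suc j) (rootIn? j)
#RootOut j = count (suc j) (rootOut? j)
#RootFree j = count (suc j) (rootFree? j)
#RootUndominated j = count (suc j) (rootUndominated? j)

#Maximal-split : ∀ j → #Maximal (suc j) ≡ #RootIn j + #RootOut j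
#Maximal-split j = count-split (maximal? (suc j)) (zero ∈?_)

#RootFree-split : ∀ j → #RootFree j ≡ #RootOut j + #RootUndominated j
#RootFree-split j =
  trans (count-split (rootFree? j) (λ S → dominated? (suc j) S zero))
        (cong (_+ #RootUndominated j)
              (count-≐ _ (rootOut? j) (rootFreeDominated⇒rootOut , rootOut⇒rootFreeDominated)))
  where
  rootFreeDominated⇒rootOut : ∀ {S} → RootFree j S × Dominated (suc j) S zero → RootOut j S
  rootFreeDominated⇒rootOut ((M , r∉) , d) = maximalOffRoot⇒maximal M (λ _ → d) , r∉
  rootOut⇒rootFreeDominated : ∀ {S} → RootOut j S → RootFree j S × Dominated (suc j) S zero
  rootOut⇒rootFreeDominated (M , r∉) = (maximal⇒maximalOffRoot M , r∉) , proj₂ M zero r∉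

#RootIn-step : ∀ j → #RootIn (3 + j) ≡ #RootFree j
#RootIn-step j = count-uniquePrefix 3 _ (rootIn? (3 + j)) (rootFree? j) rootIn-prefix (λ _ → rootIn⇔rootFree)

#RootOut-step : ∀ j → #RootOut (3 + j) ≡ #Maximal (suc j)
#RootOut-step j =
  count-uniquePrefix 3 _ (rootOut? (3 + j)) (maximal? (suc j)) rootOut-prefix (λ _ → rootOut⇔maximal)

#RootUndominated-step : ∀ j → #RootUndominated (3 + j) ≡ #RootFree j
#RootUndominated-step j =
  count-uniquePrefix 3 _ (rootUndominated? (3 + j)) (rootFree? j)
    rootUndominated-prefix (λ _ → rootUndominated⇔rootFree)

2^m+2^m≡2^1+m : ∀ m → 2 ^ m + 2 ^ m ≡ 2 ^ suc m
2^m+2^m≡2^1+m m = cong (2 ^ m +_) (sym (+-identityʳ (2 ^ m)))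

#Root≡2^m : ∀ m → let j = 3 * suc m in
  #RootIn j ≡ 2 ^ m × #RootOut j ≡ 2 ^ m × #RootUndominated j ≡ 2 ^ m
-- On the one-vertex graph, #RootFree 0 and #Maximal 1 evaluate to 1.
#Root≡2^m zero = #RootIn-step 0 , #RootOut-step 0 , #RootUndominated-step 0
#Root≡2^m (suc m) = in′ , out′ , undominated′
  where
  open ≡-Reasoning
  j = 3 * suc m
  in≡ = proj₁ (#Root≡2^m m)
  out≡ = proj₁ (proj₂ (#Root≡2^m m))
  undominated≡ = proj₂ (proj₂ (#Root≡2^m m))

  j′≡3+j : 3 * suc (suc m) ≡ 3 + j
  j′≡3+j = *-suc 3 (suc m)

  double : ∀ {a b} → a ≡ 2 ^ m → b ≡ 2 ^ m → a + b ≡ 2 ^ suc m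
  double a≡ b≡ = trans (cong₂ _+_ a≡ b≡) (2^m+2^m≡2^1+m m)

  in′ : #RootIn (3 * suc (suc m)) ≡ 2 ^ suc m
  in′ = trans (cong #RootIn j′≡3+j) (begin
    #RootIn (3 + j)                   ≡⟨ #RootIn-step j ⟩
    #RootFree j                       ≡⟨ #RootFree-split j ⟩
    #RootOut j + #RootUndominated j   ≡⟨ double out≡ undominated≡ ⟩
    2 ^ suc m                         ∎)

  out′ : #RootOut (3 * suc (suc m)) ≡ 2 ^ suc m
  out′ = trans (cong #RootOut j′≡3+j) (begin
    #RootOut (3 + j)                  ≡⟨ #RootOut-step j ⟩
    #Maximal (suc j)                  ≡⟨ #Maximal-split j ⟩
    #RootIn j + #RootOut j            ≡⟨ double in≡ out≡ ⟩
    2 ^ suc m                         ∎)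

  undominated′ : #RootUndominated (3 * suc (suc m)) ≡ 2 ^ suc m
  undominated′ = trans (cong #RootUndominated j′≡3+j) (begin
    #RootUndominated (3 + j)          ≡⟨ #RootUndominated-step j ⟩
    #RootFree j                       ≡⟨ #RootFree-split j ⟩
    #RootOut j + #RootUndominated j   ≡⟨ double out≡ undominated≡ ⟩
    2 ^ suc m                         ∎)

s≡2^n : ∀ m → s (suc m) ≡ 2 ^ suc m
s≡2^n m = begin
  s (suc m)                          ≡⟨ s≡#Maximal (suc m) ⟩
  #Maximal (order (suc m))           ≡⟨ #Maximal-split j ⟩
  #RootIn j + #RootOut j             ≡⟨ cong₂ _+_ (proj₁ (#Root≡2^m m)) (proj₁ (proj₂ (#Root≡2^m m))) ⟩
  2 ^ m + 2 ^ m                      ≡⟨ 2^m+2^m≡2^1+m m ⟩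
  2 ^ suc m                          ∎
  where
  open ≡-Reasoning
  j = 3 * suc m

theorem2p8 : (s 1 ≡ 2)
    × (∀ (n : ℕ) → n ≥ 2 → s n ≡ 2 * s (n ∸ 1))
    × (∀ (n : ℕ) → n ≥ 1 → s n ≡ 2 ^ n)
theorem2p8 = s≡2^n 0 , doubling , closedForm
  where
  closedForm : ∀ n → n ≥ 1 → s n ≡ 2 ^ n
  closedForm (suc m) _ = s≡2^n m

  doubling : ∀ n → n ≥ 2 → s n ≡ 2 * s (n ∸ 1)
  doubling (suc (suc m)) _ = trans (s≡2^n (suc m)) (cong (2 *_) (sym (s≡2^n m)))
  doubling 1 (s≤s ())
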